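{- For all positive integers $n,m,k$, $Z_{\mathcal{C}}(m,n;k,k)\le (m+n)(k-1)$, where $\mathcal{C}$ is the class of chordal bipartite graphs.
   Context: A bipartite graph is chordal bipartite if every cycle of length at least six has a chord. $Z_{\mathcal{C}}(m,n;k,k)$ is the maximum number of edges of a graph $G=(U\cup V,E)\in\mathcal{C}$ with $|U|=m$, $|V|=n$ that does not contain $K_{k,k}$ as a subgraph. -}

module Defs where

open import Data.Nat using (ℕ; zero; suc; _+_; _*_; _∸_; _≤_)
open import Data.Nat.ListAction using (sum)
open import Data.Bool using (Bool; true; false)
open import Data.Fin using (Fin; zero; suc)
open import Data.List using (List; map; allFin)
open import Data.Product using (Σ; ∃; _×_; _,_)
open import Function.Definitions using (Injective)
open import Relation.Binary.PropositionalEquality using (_≡_; _≢_)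
open import Relation.Nullary using (¬_)

-- A (simple) bipartite graph G = (U ∪ V, E) with U = Fin m, V = Fin n,
-- given by its (decidable) biadjacency relation.
BipGraph : ℕ → ℕ → Set
BipGraph m n = Fin m → Fin n → Bool

edgeCount : ∀ {m n} → BipGraph m n → ℕ
edgeCount {m} {n} E =
  sum (map (λ u → sum (map (λ v → Data.Bool.if E u v then 1 else 0) (allFin n))) (allFin m))

-- cyclic successor on Fin (suc k): i ↦ i + 1 mod (suc k)
csuc : ∀ {k} → Fin (suc k) → Fin (suc k)
csuc {zero} zero = zero
csuc {suc k} zero = suc zero
csuc {suc k} (suc i) with csuc {k} i
... | zero = zero
... | suc j = suc (suc j)

-- A cycle of length 2ℓ (ℓ = l + 3, i.e. length ≥ 6) in a bipartite graph:
-- u₀ v₀ u₁ v₁ … u_{ℓ-1} v_{ℓ-1} u₀ with distinct vertices, edges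
-- uᵢvᵢ and vᵢu_{i+1 mod ℓ}.
record Cycle {m n : ℕ} (E : BipGraph m n) (l : ℕ) : Set where
  field
    u : Fin (3 + l) → Fin m
    v : Fin (3 + l) → Fin n
    u-inj : Injective _≡_ _≡_ u
    v-inj : Injective _≡_ _≡_ v
    edge₁ : ∀ i → E (u i) (v i) ≡ true
    edge₂ : ∀ i → E (u (csuc i)) (v i) ≡ true

-- A chord: an edge of G joining two cycle vertices that is not a cycle edge.
-- (In a bipartite graph every edge joins some uᵢ and some vⱼ; it is a cycle
-- edge iff i = j or i = j + 1 mod ℓ.)
HasChord : ∀ {m n} {E : BipGraph m n} {l} → Cycle E l → Set
HasChord {E = E} {l} C =
  Σ (Fin (3 + l)) λ i → Σ (Fin (3 + l)) λ j →
    (i ≢ j) × (i ≢ csuc j) × (E (Cycle.u C i) (Cycle.v C j) ≡ true)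

ChordalBipartite : ∀ {m n} → BipGraph m n → Set
ChordalBipartite E = ∀ l (C : Cycle E l) → HasChord C

ContainsKkk : ∀ {m n} → BipGraph m n → ℕ → Set
ContainsKkk {m} {n} E k =
  Σ (Fin k → Fin m) λ a → Σ (Fin k → Fin n) λ b →
    Injective _≡_ _≡_ a × Injective _≡_ _≡_ b × (∀ i j → E (a i) (b j) ≡ true)

-- Every nonempty induced subgraph H of a K_{k,k}-free chordal bipartite graph has a vertex of degree
-- less than k in H, so deleting such vertices one at a time removes all edges, at most k − 1 at a time.
-- The low vertex is found next to a weakly simplicial vertex x of H, one whose neighbours have
-- neighbourhoods forming a chain under inclusion: if x and its neighbour of least degree both had
-- degree at least k, their neighbourhoods would span a K_{k,k}. Weakly simplicial vertices exist in
-- chordal bipartite graphs because shortest walks between neighbourhoods close up to chordless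
-- cycles, and chordless hexagons give a Helly property for neighbourhoods.

module Submission where

open import Defs
open import Data.Bool using (Bool; true; false; if_then_else_; _∧_; _∨_; not; T)
open import Data.Bool.Properties using (∧-zeroʳ; ∧-identityʳ; ¬-not)
import Data.Bool.Properties as Bool
open import Data.Empty using (⊥; ⊥-elim)
open import Data.Fin using (Fin; zero; suc; toℕ)
open import Data.Fin.Properties using (toℕ-injective; toℕ<n; any?)
import Data.Fin.Properties as Fin
open import Data.List using ([]; _∷_; map; tabulate; filter; allFin)
open import Data.List.Membership.Propositional using (_∈_)
open import Data.List.Membership.Propositional.Properties using (∈-filter⁺; ∈-filter⁻; ∈-allFin)
open import Data.List.Relation.Unary.All as All using (All; []; _∷_)
open import Data.Nat using (ℕ; zero; suc; _+_; _*_; _∸_; _≤_; _<_; z≤n; s≤s; _≡ᵇ_; _≤?_; _<?_; _≟_; NonZero)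
open import Data.Nat.Induction using (<-wellFounded)
import Data.Nat.ListAction as List
open import Data.Nat.Properties
open import Algebra.Properties.CommutativeMonoid.Sum +-0-commutativeMonoid
  using (sum; sum-cong-≗; ∑-distrib-+; sum-replicate-zero)
open import Data.Product using (Σ; ∃; _×_; _,_; proj₁; proj₂)
open import Data.Sum using (_⊎_; inj₁; inj₂)
open import Function using (_∘_; id; case_of_)
open import Function.Definitions using (Injective)
open import Induction.WellFounded using (Acc; acc)
open import Relation.Binary.Definitions using (tri<; tri≈; tri>)
open import Relation.Binary.PropositionalEquality hiding ([_])
open import Relation.Nullary using (¬_; Dec; yes; no; does)
open import Relation.Nullary.Decidable using (_×-dec_; ¬?; dec-true)

false≢true : false ≡ true → ⊥
false≢true ()

∧-intro : ∀ {a b} → a ≡ true → b ≡ true → a ∧ b ≡ true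
∧-intro refl refl = refl

∧-elimˡ : ∀ {a b} → a ∧ b ≡ true → a ≡ true
∧-elimˡ {true} _ = refl

∧-elimʳ : ∀ {a b} → a ∧ b ≡ true → b ≡ true
∧-elimʳ {true} e = e

∨-introˡ : ∀ {a b} → a ≡ true → a ∨ b ≡ true
∨-introˡ refl = refl

∨-introʳ : ∀ {a b} → b ≡ true → a ∨ b ≡ true
∨-introʳ {true} _ = refl
∨-introʳ {false} e = e

∨-elim : ∀ {a b} → a ∨ b ≡ true → a ≡ true ⊎ b ≡ true
∨-elim {true} _ = inj₁ refl
∨-elim {false} e = inj₂ e

not-true : ∀ {b} → not b ≡ true → b ≡ false
not-true {false} _ = refl

not-false : ∀ {b} → b ≡ false → not b ≡ true
not-false refl = refl

_─_ : ∀ {n} → (Fin n → Bool) → Fin n → Fin n → Bool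
(p ─ z) x = p x ∧ not (does (x Fin.≟ z))

─-self : ∀ {n} (p : Fin n → Bool) z → (p ─ z) z ≡ false
─-self p z with z Fin.≟ z
... | yes _ = ∧-zeroʳ (p z)
... | no z≢z = ⊥-elim (z≢z refl)

─-other : ∀ {n} (p : Fin n → Bool) {z x} → x ≢ z → (p ─ z) x ≡ p x
─-other p {z} {x} x≢z with x Fin.≟ z
... | yes x≡z = ⊥-elim (x≢z x≡z)
... | no _ = ∧-identityʳ (p x)

─-⊆ : ∀ {n} (p : Fin n → Bool) {z x} → (p ─ z) x ≡ true → p x ≡ true
─-⊆ p e = ∧-elimˡ e

─-≢ : ∀ {n} (p : Fin n → Bool) {z x} → (p ─ z) x ≡ true → x ≢ z
─-≢ p {z} e refl = false≢true (trans (sym (─-self p z)) e)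

─-intro : ∀ {n} (p : Fin n → Bool) {z x} → p x ≡ true → x ≢ z → (p ─ z) x ≡ true
─-intro p px x≢z = trans (─-other p x≢z) px

-- Cycles

cycSuc : ℕ → ℕ → ℕ
cycSuc L i = if suc i ≡ᵇ L then 0 else suc i

cycSuc-< : ∀ L i → suc i < L → cycSuc L i ≡ suc i
cycSuc-< L i lt with suc i ≡ᵇ L in eq
... | false = refl
... | true = ⊥-elim (<⇒≢ lt (≡ᵇ⇒≡ (suc i) L (subst T (sym eq) _)))

cycSuc-last : ∀ i → cycSuc (suc i) i ≡ 0
cycSuc-last i with suc i ≡ᵇ suc i in eq
... | true = refl
... | false = ⊥-elim (subst T eq (≡⇒≡ᵇ (suc i) (suc i) refl))

toℕ-csuc : ∀ {k} (i : Fin (suc k)) → toℕ (csuc i) ≡ cycSuc (suc k) (toℕ i)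
toℕ-csuc {zero} zero = refl
toℕ-csuc {suc k} zero = refl
toℕ-csuc {suc k} (suc i) =
  trans (toℕ-csuc-suc i) (trans (cong sucUnlessZero (toℕ-csuc i)) (sym (cycSuc-suc (suc k) (toℕ i))))
  where
  sucUnlessZero : ℕ → ℕ
  sucUnlessZero zero = zero
  sucUnlessZero (suc j) = suc (suc j)

  toℕ-csuc-suc : ∀ {k} (i : Fin (suc k)) → toℕ (csuc {suc k} (suc i)) ≡ sucUnlessZero (toℕ (csuc i))
  toℕ-csuc-suc {k} i with csuc {k} i
  ... | zero = refl
  ... | suc j = refl

  cycSuc-suc : ∀ L t → cycSuc (suc L) (suc t) ≡ sucUnlessZero (cycSuc L t)
  cycSuc-suc L t with suc t ≡ᵇ L
  ... | true = refl
  ... | false = refl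

-- A Cycle of length 2L as in Defs, but indexed by ℕ, and without chords.
record ChordlessCycle {m n} (E : BipGraph m n) (L : ℕ) : Set where
  field
    u : ℕ → Fin m
    v : ℕ → Fin n
    u-inj : ∀ i j → i < L → j < L → u i ≡ u j → i ≡ j
    v-inj : ∀ i j → i < L → j < L → v i ≡ v j → i ≡ j
    edge₁ : ∀ i → i < L → E (u i) (v i) ≡ true
    edge₂ : ∀ i → i < L → E (u (cycSuc L i)) (v i) ≡ true
    chordless : ∀ i j → i < L → j < L → E (u i) (v j) ≡ true → i ≡ j ⊎ i ≡ cycSuc L j

chordal⇒¬chordlessCycle : ∀ {m n} {E : BipGraph m n} → ChordalBipartite E → ∀ {L} → 3 ≤ L → ¬ ChordlessCycle E L
chordal⇒¬chordlessCycle {E = E} chordal {suc (suc (suc l))} (s≤s (s≤s (s≤s _))) C with chordal l cycle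
  where
  open ChordlessCycle C
  cycle : Cycle E l
  cycle = record
    { u = λ i → u (toℕ i)
    ; v = λ i → v (toℕ i)
    ; u-inj = λ {i} {j} eq → toℕ-injective (u-inj (toℕ i) (toℕ j) (toℕ<n i) (toℕ<n j) eq)
    ; v-inj = λ {i} {j} eq → toℕ-injective (v-inj (toℕ i) (toℕ j) (toℕ<n i) (toℕ<n j) eq)
    ; edge₁ = λ i → edge₁ (toℕ i) (toℕ<n i)
    ; edge₂ = λ i → subst (λ z → E (u z) (v (toℕ i)) ≡ true) (sym (toℕ-csuc i)) (edge₂ (toℕ i) (toℕ<n i))
    }
... | i , j , i≢j , i≢csuc-j , e with ChordlessCycle.chordless C (toℕ i) (toℕ j) (toℕ<n i) (toℕ<n j) e
... | inj₁ eq = i≢j (toℕ-injective eq)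
... | inj₂ eq = i≢csuc-j (toℕ-injective (trans eq (sym (toℕ-csuc j))))

-- Counting

sum-tabulate : ∀ {A : Set} n (f : Fin n → A) (h : A → ℕ) → List.sum (map h (tabulate f)) ≡ sum (λ i → h (f i))
sum-tabulate zero f h = refl
sum-tabulate (suc n) f h = cong (h (f zero) +_) (sum-tabulate n (λ i → f (suc i)) h)

sum-zero : ∀ {n} (f : Fin n → ℕ) → (∀ i → f i ≡ 0) → sum f ≡ 0
sum-zero {n} f f≗0 = trans (sum-cong-≗ f≗0) (sum-replicate-zero n)

sum-mono-≤ : ∀ {n} {f g : Fin n → ℕ} → (∀ i → f i ≤ g i) → sum f ≤ sum g
sum-mono-≤ {zero} f≤g = z≤n
sum-mono-≤ {suc n} f≤g = +-mono-≤ (f≤g zero) (sum-mono-≤ (λ i → f≤g (suc i)))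

sum-update : ∀ {n} (f g : Fin n → ℕ) z → (∀ i → i ≢ z → f i ≡ g i) → g z ≡ 0 → sum f ≡ sum g + f z
sum-update {suc n} f g zero f≗g gz rewrite gz | sum-cong-≗ {y = λ i → g (suc i)} (λ i → f≗g (suc i) (λ ())) =
  +-comm (f zero) _
sum-update {suc n} f g (suc z) f≗g gz
  rewrite f≗g zero (λ ()) | sum-update (λ i → f (suc i)) (λ i → g (suc i)) z (λ i i≢z → f≗g (suc i) (i≢z ∘ Fin.suc-injective)) gz =
  sym (+-assoc (g zero) _ (f (suc z)))

[_] : Bool → ℕ
[ b ] = if b then 1 else 0

count : ∀ {n} → (Fin n → Bool) → ℕ
count p = sum (λ i → [ p i ])

any-true? : ∀ {n} (p : Fin n → Bool) → Dec (∃ λ i → p i ≡ true)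
any-true? p = any? (λ i → p i Bool.≟ true)

count≤n : ∀ {n} (p : Fin n → Bool) → count p ≤ n
count≤n {zero} p = z≤n
count≤n {suc n} p = +-mono-≤ ([]≤1 (p zero)) (count≤n (λ i → p (suc i)))
  where
  []≤1 : ∀ b → [ b ] ≤ 1
  []≤1 true = ≤-refl
  []≤1 false = z≤n

count-full : ∀ n → count {n} (λ _ → true) ≡ n
count-full zero = refl
count-full (suc n) = cong suc (count-full n)

count-empty : ∀ {n} (p : Fin n → Bool) → (∀ i → p i ≡ false) → count p ≡ 0
count-empty p p≗false = sum-zero _ (λ i → cong [_] (p≗false i))

[]-mono : ∀ {a b} → (a ≡ true → b ≡ true) → [ a ] ≤ [ b ]
[]-mono {false} _ = z≤n
[]-mono {true} a⇒b rewrite a⇒b refl = ≤-refl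

count-mono : ∀ {n} {p q : Fin n → Bool} → (∀ i → p i ≡ true → q i ≡ true) → count p ≤ count q
count-mono p⊆q = sum-mono-≤ (λ i → []-mono (p⊆q i))

count-strict : ∀ {n} {p q : Fin n → Bool} → (∀ i → p i ≡ true → q i ≡ true) →
  ∀ z → q z ≡ true → p z ≡ false → count p < count q
count-strict {suc n} p⊆q zero qz pz rewrite qz | pz = s≤s (count-mono (λ i → p⊆q (suc i)))
count-strict {suc n} p⊆q (suc z) qz pz =
  +-mono-≤-< ([]-mono (p⊆q zero)) (count-strict (λ i → p⊆q (suc i)) z qz pz)

∃⇒count>0 : ∀ {n} (p : Fin n → Bool) → ∃ (λ i → p i ≡ true) → 0 < count p
∃⇒count>0 p (i , pi) = ≤-trans (s≤s z≤n) (count-strict {p = λ _ → false} (λ _ ()) i pi refl)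

count>0⇒∃ : ∀ {n} (p : Fin n → Bool) → 0 < count p → ∃ λ i → p i ≡ true
count>0⇒∃ p pos with any-true? p
... | yes ex = ex
... | no ¬ex = ⊥-elim (<⇒≢ pos (sym (count-empty p (λ i → ¬-not (λ pi → ¬ex (i , pi))))))

count-remove : ∀ {n} (p : Fin n → Bool) {z} → p z ≡ true → count p ≡ suc (count (p ─ z))
count-remove p {z} pz = begin
  count p                ≡⟨ sum-update _ _ z (λ i i≢z → cong [_] (sym (─-other p i≢z))) (cong [_] (─-self p z)) ⟩
  count (p ─ z) + [ p z ] ≡⟨ cong (λ b → count (p ─ z) + [ b ]) pz ⟩
  count (p ─ z) + 1       ≡⟨ +-comm _ 1 ⟩
  suc (count (p ─ z))     ∎
  where open ≡-Reasoning

count-⊆⇒⊇ : ∀ {n} {p q : Fin n → Bool} → (∀ i → p i ≡ true → q i ≡ true) → count q ≤ count p →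
  ∀ i → q i ≡ true → p i ≡ true
count-⊆⇒⊇ {p = p} p⊆q q≤p i qi with p i in pi
... | true = refl
... | false = ⊥-elim (<⇒≱ (count-strict p⊆q i qi pi) q≤p)

count≥⇒injection : ∀ {n} k (p : Fin n → Bool) → k ≤ count p →
  Σ (Fin k → Fin n) λ f → Injective _≡_ _≡_ f × (∀ i → p (f i) ≡ true)
count≥⇒injection zero p _ = (λ ()) , (λ { {()} }) , (λ ())
count≥⇒injection {zero} (suc k) p ()
count≥⇒injection {suc n} (suc k) p k<count with p zero in p0
... | true =
  let (f , f-inj , pf) = count≥⇒injection k (p ∘ suc) (≤-pred k<count) in
  (λ { zero → zero ; (suc i) → suc (f i) }) ,
  (λ { {zero} {zero} _ → refl ; {zero} {suc _} () ; {suc _} {zero} ()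
     ; {suc i} {suc j} eq → cong suc (f-inj (Fin.suc-injective eq)) }) ,
  (λ { zero → p0 ; (suc i) → pf i })
... | false =
  let (f , f-inj , pf) = count≥⇒injection (suc k) (p ∘ suc) k<count in
  suc ∘ f , f-inj ∘ Fin.suc-injective , pf

argmin : ∀ {n} (p : Fin n → Bool) (c : Fin n → ℕ) → ∃ (λ i → p i ≡ true) →
  Σ (Fin n) λ i → p i ≡ true × (∀ j → p j ≡ true → c i ≤ c j)
argmin {suc n} p c (i₀ , pi₀) with any-true? (p ∘ suc)
... | no none = zero , p0 i₀ pi₀ , λ { zero _ → ≤-refl ; (suc j) pj → ⊥-elim (none (j , pj)) }
  where
  p0 : ∀ i → p i ≡ true → p zero ≡ true
  p0 zero pi = pi
  p0 (suc j) pj = ⊥-elim (none (j , pj))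
... | yes ex with argmin (p ∘ suc) (c ∘ suc) ex
... | j , pj , min-j with p zero in p0
...   | false = suc j , pj , λ { zero p0′ → ⊥-elim (false≢true (trans (sym p0) p0′)) ; (suc k) pk → min-j k pk }
...   | true with c zero ≤? c (suc j)
...     | yes c0≤ = zero , p0 , λ { zero _ → ≤-refl ; (suc k) pk → ≤-trans c0≤ (min-j k pk) }
...     | no c0≰ = suc j , pj , λ { zero _ → <⇒≤ (≰⇒> c0≰) ; (suc k) pk → min-j k pk }

-- Walks

m∸n≡1+m∸[1+n] : ∀ {m n} → n < m → m ∸ n ≡ suc (m ∸ suc n)
m∸n≡1+m∸[1+n] {suc m} {zero} _ = refl
m∸n≡1+m∸[1+n] {suc m} {suc n} (s≤s n<m) = m∸n≡1+m∸[1+n] n<m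

module Walks {m n : ℕ} (E : BipGraph m n) (CU : Fin m → Bool) (CV : Fin n → Bool) where

  -- ys 0, xs 0, ys 1, xs 1, …, xs (len ∸ 1), ys len
  record Walk : Set where
    field
      len : ℕ
      xs : ℕ → Fin m
      ys : ℕ → Fin n
      edge₁ : ∀ i → i < len → E (xs i) (ys i) ≡ true
      edge₂ : ∀ i → i < len → E (xs i) (ys (suc i)) ≡ true
      xs∈C : ∀ i → i < len → CU (xs i) ≡ true
      ys∈C : ∀ i → i ≤ len → CV (ys i) ≡ true

  -- r = xs 0, ys 0, xs 1, ys 1, …, xs len, ys len = y
  record RootedWalk (r : Fin m) (y : Fin n) : Set where
    field
      len : ℕ
      xs : ℕ → Fin m
      ys : ℕ → Fin n
      start : xs 0 ≡ r
      end : ys len ≡ y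
      edge₁ : ∀ i → i ≤ len → E (xs i) (ys i) ≡ true
      edge₂ : ∀ i → i < len → E (xs (suc i)) (ys i) ≡ true
      xs∈C : ∀ i → i ≤ len → CU (xs i) ≡ true
      ys∈C : ∀ i → i ≤ len → CV (ys i) ≡ true

  open Walk

  prefix : (w : Walk) (t : ℕ) → t ≤ len w → Walk
  prefix w t t≤len = record
    { len = t ; xs = xs w ; ys = ys w
    ; edge₁ = λ i i<t → edge₁ w i (<-≤-trans i<t t≤len)
    ; edge₂ = λ i i<t → edge₂ w i (<-≤-trans i<t t≤len)
    ; xs∈C = λ i i<t → xs∈C w i (<-≤-trans i<t t≤len)
    ; ys∈C = λ i i≤t → ys∈C w i (≤-trans i≤t t≤len)
    }

  suffix : (w : Walk) (s o : ℕ) → o + s ≡ len w → Walk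
  suffix w s o o+s≡len = record
    { len = o ; xs = λ i → xs w (i + s) ; ys = λ i → ys w (i + s)
    ; edge₁ = λ i i<o → edge₁ w (i + s) (shift< i<o)
    ; edge₂ = λ i i<o → edge₂ w (i + s) (shift< i<o)
    ; xs∈C = λ i i<o → xs∈C w (i + s) (shift< i<o)
    ; ys∈C = λ i i≤o → ys∈C w (i + s) (subst (i + s ≤_) o+s≡len (+-monoˡ-≤ s i≤o))
    }
    where
    shift< : ∀ {i} → i < o → i + s < len w
    shift< i<o = subst (_ <_) o+s≡len (+-monoˡ-< s i<o)

  -- Skips the positions t, …, t + d ∸ 1.
  skip : ℕ → ℕ → ℕ → ℕ
  skip t d k with k <? t
  ... | yes _ = k
  ... | no _ = k + d

  skip-below : ∀ {t} d {k} → k < t → skip t d k ≡ k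
  skip-below {t} d {k} k<t with k <? t
  ... | yes _ = refl
  ... | no k≮t = ⊥-elim (k≮t k<t)

  skip-above : ∀ {t} d {k} → t ≤ k → skip t d k ≡ k + d
  skip-above {t} d {k} t≤k with k <? t
  ... | yes k<t = ⊥-elim (<⇒≱ k<t t≤k)
  ... | no _ = refl

  skip-mono-≤ : ∀ t d {k l} → k ≤ l → skip t d k ≤ l + d
  skip-mono-≤ t d {k} k≤l with k <? t
  ... | yes _ = ≤-trans k≤l (m≤m+n _ d)
  ... | no _ = +-monoˡ-≤ d k≤l

  skip-mono-< : ∀ t d {k l} → k < l → skip t d k < l + d
  skip-mono-< t d {k} k<l with k <? t
  ... | yes _ = <-≤-trans k<l (m≤m+n _ d)
  ... | no _ = +-monoˡ-< d k<l

  record Shortening (w : Walk) : Set where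
    field
      walk : Walk
      shorter : len walk < len w
      same-start : ys walk 0 ≡ ys w 0
      same-end : ys walk (len walk) ≡ ys w (len w)

  shortcut : (w : Walk) (len′ d tx ty : ℕ) → len w ≡ len′ + d → 0 < d → 0 < ty → ty ≤ len′ →
    (∀ k → k < len′ → E (xs w (skip tx d k)) (ys w (skip ty d k)) ≡ true) →
    (∀ k → k < len′ → E (xs w (skip tx d k)) (ys w (skip ty d (suc k))) ≡ true) →
    Shortening w
  shortcut w len′ d tx ty len≡ d>0 ty>0 ty≤len′ edge₁′ edge₂′ = record
    { walk = record
      { len = len′ ; xs = xs w ∘ skip tx d ; ys = ys w ∘ skip ty d
      ; edge₁ = edge₁′ ; edge₂ = edge₂′
      ; xs∈C = λ k k<len′ → xs∈C w _ (subst (_ <_) (sym len≡) (skip-mono-< tx d k<len′))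
      ; ys∈C = λ k k≤len′ → ys∈C w _ (subst (_ ≤_) (sym len≡) (skip-mono-≤ ty d k≤len′))
      }
    ; shorter = subst (len′ <_) (sym len≡) (m<m+n len′ d>0)
    ; same-start = cong (ys w) (skip-below d ty>0)
    ; same-end = cong (ys w) (trans (skip-above d ty≤len′) (sym len≡))
    }

  module _ (w : Walk) {d : ℕ} (d≤len : d ≤ len w) where
    private
      reindex : ∀ {a a′ b b′} → a ≡ a′ → b ≡ b′ → E (xs w a′) (ys w b′) ≡ true → E (xs w a) (ys w b) ≡ true
      reindex refl refl e = e

      len′ : ℕ
      len′ = len w ∸ d
      len≡ : len w ≡ len′ + d
      len≡ = sym (m∸n+n≡m d≤len)

      below : ∀ {k} → k < len′ → k < len w
      below k<len′ = subst (_ <_) (sym len≡) (<-≤-trans k<len′ (m≤m+n len′ d))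

      above : ∀ {k} → k < len′ → k + d < len w
      above k<len′ = subst (_ <_) (sym len≡) (+-monoˡ-< d k<len′)

    forwardChord : ∀ i → 0 < d → suc i + d ≤ len w → E (xs w i) (ys w (suc i + d)) ≡ true → Shortening w
    forwardChord i d>0 si+d≤len chord =
      shortcut w len′ d (suc i) (suc i) len≡ d>0 (s≤s z≤n) (m+n≤o⇒m≤o∸n (suc i) si+d≤len) edge₁′ edge₂′
      where
      edge₁′ : ∀ k → k < len′ → E (xs w (skip (suc i) d k)) (ys w (skip (suc i) d k)) ≡ true
      edge₁′ k k<len′ with <-≤-connex k (suc i)
      ... | inj₁ k≤i = reindex (skip-below d k≤i) (skip-below d k≤i) (edge₁ w k (below k<len′))
      ... | inj₂ i<k = reindex (skip-above d i<k) (skip-above d i<k) (edge₁ w (k + d) (above k<len′))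
      edge₂′ : ∀ k → k < len′ → E (xs w (skip (suc i) d k)) (ys w (skip (suc i) d (suc k))) ≡ true
      edge₂′ k k<len′ with <-cmp k i
      ... | tri< k<i _ _ = reindex (skip-below d (m<n⇒m<1+n k<i)) (skip-below d (s≤s k<i)) (edge₂ w k (below k<len′))
      ... | tri≈ _ refl _ = reindex (skip-below d (n<1+n k)) (skip-above d (≤-refl {suc k})) chord
      ... | tri> _ _ i<k = reindex (skip-above d i<k) (skip-above d (m<n⇒m<1+n i<k)) (edge₂ w (k + d) (above k<len′))

    backwardChord : ∀ j → 0 < d → j + d < len w → E (xs w (j + d)) (ys w j) ≡ true → Shortening w
    backwardChord j d>0 j+d<len chord =
      shortcut w len′ d j (suc j) len≡ d>0 (s≤s z≤n) (m+n≤o⇒m≤o∸n (suc j) j+d<len) edge₁′ edge₂′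
      where
      edge₁′ : ∀ k → k < len′ → E (xs w (skip j d k)) (ys w (skip (suc j) d k)) ≡ true
      edge₁′ k k<len′ with <-cmp k j
      ... | tri< k<j _ _ = reindex (skip-below d k<j) (skip-below d (m<n⇒m<1+n k<j)) (edge₁ w k (below k<len′))
      ... | tri≈ _ refl _ = reindex (skip-above d (≤-refl {k})) (skip-below d (n<1+n k)) chord
      ... | tri> _ _ j<k = reindex (skip-above d (<⇒≤ j<k)) (skip-above d j<k) (edge₁ w (k + d) (above k<len′))
      edge₂′ : ∀ k → k < len′ → E (xs w (skip j d k)) (ys w (skip (suc j) d (suc k))) ≡ true
      edge₂′ k k<len′ with <-≤-connex k j
      ... | inj₁ k<j = reindex (skip-below d k<j) (skip-below d (s≤s k<j)) (edge₂ w k (below k<len′))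
      ... | inj₂ j≤k = reindex (skip-above d j≤k) (skip-above d (s≤s j≤k)) (edge₂ w (k + d) (above k<len′))

  single : ∀ {r y} → CU r ≡ true → CV y ≡ true → E r y ≡ true → RootedWalk r y
  single {r} {y} r∈C y∈C ry = record
    { len = 0 ; xs = λ _ → r ; ys = λ _ → y ; start = refl ; end = refl
    ; edge₁ = λ _ _ → ry ; edge₂ = λ _ () ; xs∈C = λ _ _ → r∈C ; ys∈C = λ _ _ → y∈C }

  extend : ∀ {r y′ y} x → RootedWalk r y′ → E x y′ ≡ true → E x y ≡ true → CU x ≡ true → CV y ≡ true → RootedWalk r y
  extend {r} {y′} {y} x W xy′ xy x∈C y∈C = record
    { len = suc l ; xs = xs′ ; ys = ys′ ; start = W.start ; end = end
    ; edge₁ = edge₁′ ; edge₂ = edge₂′ ; xs∈C = xs∈C′ ; ys∈C = ys∈C′ }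
    where
    module W = RootedWalk W
    l : ℕ
    l = W.len
    xs′ : ℕ → Fin m
    xs′ i with i ≤? l
    ... | yes _ = W.xs i
    ... | no _ = x
    ys′ : ℕ → Fin n
    ys′ i with i ≤? l
    ... | yes _ = W.ys i
    ... | no _ = y
    end : ys′ (suc l) ≡ y
    end with suc l ≤? l
    ... | yes l<l = ⊥-elim (<-irrefl refl l<l)
    ... | no _ = refl
    edge₁′ : ∀ i → i ≤ suc l → E (xs′ i) (ys′ i) ≡ true
    edge₁′ i _ with i ≤? l
    ... | yes i≤l = W.edge₁ i i≤l
    ... | no _ = xy
    edge₂′ : ∀ i → i < suc l → E (xs′ (suc i)) (ys′ i) ≡ true
    edge₂′ i i<1+l with i ≤? l | suc i ≤? l
    ... | yes _ | yes i<l = W.edge₂ i i<l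
    ... | yes i≤l | no i≮l with ≤-antisym i≤l (≤-pred (≰⇒> i≮l))
    ...   | refl = subst (λ z → E x z ≡ true) (sym W.end) xy′
    edge₂′ i i<1+l | no i≰l | _ = ⊥-elim (i≰l (≤-pred i<1+l))
    xs∈C′ : ∀ i → i ≤ suc l → CU (xs′ i) ≡ true
    xs∈C′ i _ with i ≤? l
    ... | yes i≤l = W.xs∈C i i≤l
    ... | no _ = x∈C
    ys∈C′ : ∀ i → i ≤ suc l → CV (ys′ i) ≡ true
    ys∈C′ i _ with i ≤? l
    ... | yes i≤l = W.ys∈C i i≤l
    ... | no _ = y∈C

  -- The reverse of the first walk, followed by the second one.
  joinAtRoot : ∀ {r y y′} → RootedWalk r y → RootedWalk r y′ → Σ Walk λ w → ys w 0 ≡ y × ys w (len w) ≡ y′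
  joinAtRoot {r} {y} {y′} A B = walk , A.end , end
    where
    module A = RootedWalk A
    module B = RootedWalk B
    la lb L : ℕ
    la = A.len
    lb = B.len
    L = la + suc lb
    ys′ : ℕ → Fin n
    ys′ k with k ≤? la
    ... | yes _ = A.ys (la ∸ k)
    ... | no _ = B.ys (k ∸ suc la)
    xs′ : ℕ → Fin m
    xs′ k with k <? la
    ... | yes _ = A.xs (la ∸ k)
    ... | no _ = B.xs (k ∸ la)
    L∸1+la : L ∸ suc la ≡ lb
    L∸1+la = trans (cong (_∸ suc la) (+-suc la lb)) (m+n∸m≡n la lb)
    inB : ∀ {k} → la < k → k < L → k ∸ suc la < lb
    inB {k} la<k k<L = subst (k ∸ suc la <_) L∸1+la (∸-monoˡ-< k<L la<k)
    inB′ : ∀ {k} → la ≤ k → k < L → k ∸ la ≤ lb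
    inB′ {k} la≤k k<L = ≤-pred (subst (k ∸ la <_) (m+n∸m≡n la (suc lb)) (∸-monoˡ-< k<L la≤k))
    end : ys′ L ≡ y′
    end with L ≤? la
    ... | yes L≤la = ⊥-elim (<⇒≱ (m<m+n la (s≤s z≤n)) L≤la)
    ... | no _ = trans (cong B.ys L∸1+la) B.end
    edge₁′ : ∀ k → k < L → E (xs′ k) (ys′ k) ≡ true
    edge₁′ k k<L with k <? la | k ≤? la
    ... | yes _ | yes _ = A.edge₁ (la ∸ k) (m∸n≤m la k)
    ... | yes k<la | no k≰la = ⊥-elim (k≰la (<⇒≤ k<la))
    ... | no k≮la | yes k≤la with ≤-antisym k≤la (≮⇒≥ k≮la)
    ...   | refl rewrite n∸n≡0 k = subst (λ x → E x (A.ys 0) ≡ true) (trans A.start (sym B.start)) (A.edge₁ 0 z≤n)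
    edge₁′ k k<L | no _ | no k≰la rewrite m∸n≡1+m∸[1+n] (≰⇒> k≰la) = B.edge₂ (k ∸ suc la) (inB (≰⇒> k≰la) k<L)
    edge₂′ : ∀ k → k < L → E (xs′ k) (ys′ (suc k)) ≡ true
    edge₂′ k k<L with k <? la
    ... | yes k<la rewrite m∸n≡1+m∸[1+n] k<la = A.edge₂ (la ∸ suc k) (∸-monoʳ-< (s≤s z≤n) k<la)
    ... | no k≮la = B.edge₁ (k ∸ la) (inB′ (≮⇒≥ k≮la) k<L)
    xs∈C′ : ∀ k → k < L → CU (xs′ k) ≡ true
    xs∈C′ k k<L with k <? la
    ... | yes _ = A.xs∈C (la ∸ k) (m∸n≤m la k)
    ... | no k≮la = B.xs∈C (k ∸ la) (inB′ (≮⇒≥ k≮la) k<L)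
    ys∈C′ : ∀ k → k ≤ L → CV (ys′ k) ≡ true
    ys∈C′ k k≤L with k ≤? la
    ... | yes _ = A.ys∈C (la ∸ k) (m∸n≤m la k)
    ... | no _ = B.ys∈C (k ∸ suc la) (subst (k ∸ suc la ≤_) L∸1+la (∸-monoˡ-≤ (suc la) k≤L))
    walk : Walk
    walk = record { len = L ; xs = xs′ ; ys = ys′ ; edge₁ = edge₁′ ; edge₂ = edge₂′ ; xs∈C = xs∈C′ ; ys∈C = ys∈C′ }

-- Two vertices outside a connected set C, both adjacent to a vertex v without neighbours in C and both
-- with neighbours in C, have a common neighbour in C: take a shortest walk in C between their
-- neighbourhoods; closed up through a, v and b it is a chordless cycle of length at least 6.
module Pairwise {m n : ℕ} (E : BipGraph m n) (chordal : ChordalBipartite E)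
  (CU : Fin m → Bool) (CV : Fin n → Bool) (v : Fin n) (v∉C : CV v ≡ false)
  (v-far : ∀ x → CU x ≡ true → E x v ≡ false)
  (a b : Fin m) (av : E a v ≡ true) (bv : E b v ≡ true) where

  open Walks E CU CV
  open Walk

  CommonNeighbour : Set
  CommonNeighbour = Σ (Fin n) λ y → CV y ≡ true × E a y ≡ true × E b y ≡ true

  v-nbr∉C : ∀ {x} → E x v ≡ true → CU x ≡ false
  v-nbr∉C {x} xv with CU x in eq
  ... | false = refl
  ... | true = ⊥-elim (false≢true (trans (sym (v-far x eq)) xv))

  -- The cycle a, ys 0, xs 0, ys 1, …, xs (len ∸ 1), ys len, b, v.
  module ClosedUp (w : Walk) (len>0 : 0 < len w)
    (a-start : E a (ys w 0) ≡ true) (b-end : E b (ys w (len w)) ≡ true)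
    (a-late : ∀ j → j < len w → E a (ys w (suc j)) ≢ true)
    (b-early : ∀ j → j < len w → E b (ys w j) ≢ true)
    (chordless : ∀ i j → i < len w → j ≤ len w → E (xs w i) (ys w j) ≡ true → j ≡ i ⊎ j ≡ suc i) where

    ℓ L : ℕ
    ℓ = len w
    L = suc (suc ℓ)

    us : ℕ → Fin m
    us zero = a
    us (suc k) with k <? ℓ
    ... | yes _ = xs w k
    ... | no _ = b

    vs : ℕ → Fin n
    vs k with k ≤? ℓ
    ... | yes _ = ys w k
    ... | no _ = v

    us-inner : ∀ {k} → k < ℓ → us (suc k) ≡ xs w k
    us-inner {k} k<ℓ with k <? ℓ
    ... | yes _ = refl
    ... | no k≮ℓ = ⊥-elim (k≮ℓ k<ℓ)

    us-last : us (suc ℓ) ≡ b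
    us-last with ℓ <? ℓ
    ... | yes ℓ<ℓ = ⊥-elim (<-irrefl refl ℓ<ℓ)
    ... | no _ = refl

    vs-inner : ∀ {k} → k ≤ ℓ → vs k ≡ ys w k
    vs-inner {k} k≤ℓ with k ≤? ℓ
    ... | yes _ = refl
    ... | no k≰ℓ = ⊥-elim (k≰ℓ k≤ℓ)

    vs-last : vs (suc ℓ) ≡ v
    vs-last with suc ℓ ≤? ℓ
    ... | yes ℓ<ℓ = ⊥-elim (<-irrefl refl ℓ<ℓ)
    ... | no _ = refl

    data UIndex : ℕ → Set where
      first : UIndex 0
      inner : ∀ k → k < ℓ → UIndex (suc k)
      last : UIndex (suc ℓ)

    uIndex : ∀ i → i < L → UIndex i
    uIndex zero _ = first
    uIndex (suc k) (s≤s (s≤s k≤ℓ)) with m≤n⇒m<n∨m≡n k≤ℓ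
    ... | inj₁ k<ℓ = inner k k<ℓ
    ... | inj₂ refl = last

    data VIndex : ℕ → Set where
      inner : ∀ k → k ≤ ℓ → VIndex k
      last : VIndex (suc ℓ)

    vIndex : ∀ j → j < L → VIndex j
    vIndex j (s≤s j≤1+ℓ) with m≤n⇒m<n∨m≡n j≤1+ℓ
    ... | inj₁ j<1+ℓ = inner j (≤-pred j<1+ℓ)
    ... | inj₂ refl = last

    cycSuc-inner : ∀ {j} → j ≤ ℓ → cycSuc L j ≡ suc j
    cycSuc-inner j≤ℓ = cycSuc-< L _ (s≤s (s≤s j≤ℓ))

    a≢b : a ≢ b
    a≢b refl = b-early 0 len>0 a-start

    xs-injective : ∀ k k′ → k < ℓ → k′ < ℓ → xs w k ≡ xs w k′ → k ≡ k′
    xs-injective k k′ k<ℓ k′<ℓ eq with <-cmp k k′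
    ... | tri≈ _ k≡k′ _ = k≡k′
    ... | tri< k<k′ _ _ with chordless k (suc k′) k<ℓ k′<ℓ (subst (λ x → E x (ys w (suc k′)) ≡ true) (sym eq) (edge₂ w k′ k′<ℓ))
    ...   | inj₁ e = ⊥-elim (<-asym k<k′ (subst (k′ <_) e (n<1+n k′)))
    ...   | inj₂ e = ⊥-elim (<-irrefl (sym (suc-injective e)) k<k′)
    xs-injective k k′ k<ℓ k′<ℓ eq | tri> _ _ k′<k with chordless k′ (suc k) k′<ℓ k<ℓ (subst (λ x → E x (ys w (suc k)) ≡ true) eq (edge₂ w k k<ℓ))
    ...   | inj₁ e = ⊥-elim (<-asym k′<k (subst (k <_) e (n<1+n k)))
    ...   | inj₂ e = ⊥-elim (<-irrefl (sym (suc-injective e)) k′<k)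

    ys-distinct : ∀ j j′ → j < j′ → j′ ≤ ℓ → ys w j ≢ ys w j′
    ys-distinct j j′ j<j′ j′≤ℓ eq with chordless j j′ (<-≤-trans j<j′ j′≤ℓ) j′≤ℓ (subst (λ y → E (xs w j) y ≡ true) eq (edge₁ w j (<-≤-trans j<j′ j′≤ℓ)))
    ... | inj₁ e = <-irrefl (sym e) j<j′
    ... | inj₂ refl with m≤n⇒m<n∨m≡n j′≤ℓ
    ...   | inj₁ j′<ℓ with chordless (suc j) j j′<ℓ (<⇒≤ (<-≤-trans j<j′ j′≤ℓ)) (subst (λ y → E (xs w (suc j)) y ≡ true) (sym eq) (edge₁ w (suc j) j′<ℓ))
    ...     | inj₁ e = <-irrefl e (n<1+n j)
    ...     | inj₂ e = <-irrefl e (<-trans (n<1+n j) (n<1+n (suc j)))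
    ys-distinct j j′ j<j′ j′≤ℓ eq | inj₂ refl | inj₂ refl = b-early j (<-≤-trans j<j′ j′≤ℓ) (subst (λ y → E b y ≡ true) (sym eq) b-end)

    xs∉ : ∀ {k x} → k < ℓ → xs w k ≡ x → E x v ≡ true → ⊥
    xs∉ {k} k<ℓ refl xv = false≢true (trans (sym (v-nbr∉C xv)) (xs∈C w k k<ℓ))

    us-inj : ∀ i j → i < L → j < L → us i ≡ us j → i ≡ j
    us-inj i j i<L j<L eq with uIndex i i<L | uIndex j j<L
    ... | first | first = refl
    ... | first | inner k k<ℓ = ⊥-elim (xs∉ k<ℓ (sym (trans eq (us-inner k<ℓ))) av)
    ... | first | last = ⊥-elim (a≢b (trans eq us-last))
    ... | inner k k<ℓ | first = ⊥-elim (xs∉ k<ℓ (trans (sym (us-inner k<ℓ)) eq) av)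
    ... | inner k k<ℓ | inner k′ k′<ℓ = cong suc (xs-injective k k′ k<ℓ k′<ℓ (trans (sym (us-inner k<ℓ)) (trans eq (us-inner k′<ℓ))))
    ... | inner k k<ℓ | last = ⊥-elim (xs∉ k<ℓ (trans (sym (us-inner k<ℓ)) (trans eq us-last)) bv)
    ... | last | first = ⊥-elim (a≢b (sym (trans (sym us-last) eq)))
    ... | last | inner k k<ℓ = ⊥-elim (xs∉ k<ℓ (trans (sym (us-inner k<ℓ)) (trans (sym eq) us-last)) bv)
    ... | last | last = refl

    ys∉ : ∀ {k} → k ≤ ℓ → ys w k ≢ v
    ys∉ {k} k≤ℓ eq = false≢true (trans (sym v∉C) (subst (λ y → CV y ≡ true) eq (ys∈C w k k≤ℓ)))

    vs-inj : ∀ i j → i < L → j < L → vs i ≡ vs j → i ≡ j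
    vs-inj i j i<L j<L eq with vIndex i i<L | vIndex j j<L
    ... | inner i′ i′≤ℓ | inner j′ j′≤ℓ with <-cmp i′ j′
    ...   | tri≈ _ e _ = e
    ...   | tri< lt _ _ = ⊥-elim (ys-distinct i′ j′ lt j′≤ℓ (trans (sym (vs-inner i′≤ℓ)) (trans eq (vs-inner j′≤ℓ))))
    ...   | tri> _ _ gt = ⊥-elim (ys-distinct j′ i′ gt i′≤ℓ (trans (sym (vs-inner j′≤ℓ)) (trans (sym eq) (vs-inner i′≤ℓ))))
    vs-inj i j i<L j<L eq | inner i′ i′≤ℓ | last = ⊥-elim (ys∉ i′≤ℓ (trans (sym (vs-inner i′≤ℓ)) (trans eq vs-last)))
    vs-inj i j i<L j<L eq | last | inner j′ j′≤ℓ = ⊥-elim (ys∉ j′≤ℓ (trans (sym (vs-inner j′≤ℓ)) (trans (sym eq) vs-last)))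
    vs-inj i j i<L j<L eq | last | last = refl

    edge : ∀ {x x′ y y′} → x ≡ x′ → y ≡ y′ → E x′ y′ ≡ true → E x y ≡ true
    edge refl refl e = e

    edge₁′ : ∀ i → i < L → E (us i) (vs i) ≡ true
    edge₁′ i i<L with uIndex i i<L
    ... | first = edge refl (vs-inner z≤n) a-start
    ... | inner k k<ℓ = edge (us-inner k<ℓ) (vs-inner k<ℓ) (edge₂ w k k<ℓ)
    ... | last = edge us-last vs-last bv

    edge₂′ : ∀ i → i < L → E (us (cycSuc L i)) (vs i) ≡ true
    edge₂′ i i<L with vIndex i i<L
    ... | last = edge (cong us (cycSuc-last (suc ℓ))) vs-last av
    ... | inner j j≤ℓ with m≤n⇒m<n∨m≡n j≤ℓ
    ...   | inj₁ j<ℓ = edge (trans (cong us (cycSuc-inner j≤ℓ)) (us-inner j<ℓ)) (vs-inner j≤ℓ) (edge₁ w j j<ℓ)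
    ...   | inj₂ refl = edge (trans (cong us (cycSuc-inner j≤ℓ)) us-last) (vs-inner j≤ℓ) b-end

    chordless′ : ∀ i j → i < L → j < L → E (us i) (vs j) ≡ true → i ≡ j ⊎ i ≡ cycSuc L j
    chordless′ i j i<L j<L e with uIndex i i<L | vIndex j j<L
    ... | first | inner zero _ = inj₁ refl
    ... | first | inner (suc j′) j≤ℓ = ⊥-elim (a-late j′ j≤ℓ (edge refl (sym (vs-inner j≤ℓ)) e))
    ... | first | last = inj₂ (sym (cycSuc-last (suc ℓ)))
    ... | inner k k<ℓ | inner j′ j≤ℓ with chordless k j′ k<ℓ j≤ℓ (edge (sym (us-inner k<ℓ)) (sym (vs-inner j≤ℓ)) e)
    ...   | inj₁ refl = inj₂ (sym (cycSuc-inner j≤ℓ))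
    ...   | inj₂ refl = inj₁ refl
    chordless′ i j i<L j<L e | inner k k<ℓ | last = ⊥-elim (xs∉ k<ℓ refl (edge (sym (us-inner k<ℓ)) (sym vs-last) e))
    chordless′ i j i<L j<L e | last | inner j′ j≤ℓ with m≤n⇒m<n∨m≡n j≤ℓ
    ... | inj₁ j<ℓ = ⊥-elim (b-early j′ j<ℓ (edge (sym us-last) (sym (vs-inner j≤ℓ)) e))
    ... | inj₂ refl = inj₂ (sym (cycSuc-inner j≤ℓ))
    chordless′ i j i<L j<L e | last | last = inj₁ refl

    cycle : ChordlessCycle E L
    cycle = record
      { u = us ; v = vs ; u-inj = us-inj ; v-inj = vs-inj
      ; edge₁ = edge₁′ ; edge₂ = edge₂′ ; chordless = chordless′ }

  record Shorter (w : Walk) : Set where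
    field
      walk : Walk
      shorter : len walk < len w
      a-start : E a (ys walk 0) ≡ true
      b-end : E b (ys walk (len walk)) ≡ true

  Chord : Walk → ℕ → ℕ → Set
  Chord w i j = E (xs w i) (ys w j) ≡ true × j ≢ i × j ≢ suc i

  chord? : ∀ w i j → Dec (Chord w i j)
  chord? w i j = (E (xs w i) (ys w j) Bool.≟ true) ×-dec ¬? (j ≟ i) ×-dec ¬? (j ≟ suc i)

  chordShortening : (w : Walk) → ∀ i j → i < len w → j ≤ len w → Chord w i j → Shortening w
  chordShortening w i j i<len j≤len (e , j≢i , j≢1+i) with <-cmp j i
  ... | tri≈ _ j≡i _ = ⊥-elim (j≢i j≡i)
  ... | tri< j<i _ _ =
    backwardChord w (≤-trans (m∸n≤m i j) (<⇒≤ i<len)) j (m<n⇒0<n∸m j<i) (subst (_< len w) (sym j+d≡i) i<len)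
      (subst (λ k → E (xs w k) (ys w j) ≡ true) (sym j+d≡i) e)
    where
    j+d≡i : j + (i ∸ j) ≡ i
    j+d≡i = m+[n∸m]≡n (<⇒≤ j<i)
  ... | tri> _ _ i<j =
    forwardChord w (≤-trans (m∸n≤m j (suc i)) j≤len) i (m<n⇒0<n∸m 1+i<j) (subst (_≤ len w) (sym 1+i+d≡j) j≤len)
      (subst (λ k → E (xs w i) (ys w k) ≡ true) (sym 1+i+d≡j) e)
    where
    1+i<j : suc i < j
    1+i<j = ≤∧≢⇒< i<j (j≢1+i ∘ sym)
    1+i+d≡j : suc i + (j ∸ suc i) ≡ j
    1+i+d≡j = m+[n∸m]≡n (<⇒≤ 1+i<j)

  improve : (w : Walk) → E a (ys w 0) ≡ true → E b (ys w (len w)) ≡ true → CommonNeighbour ⊎ Shorter w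
  improve w a-start b-end with E b (ys w 0) Bool.≟ true
  ... | yes b-start = inj₁ (ys w 0 , ys∈C w 0 z≤n , a-start , b-start)
  ... | no b-not-start with anyUpTo? (λ j → E a (ys w (suc j)) Bool.≟ true) (len w)
  ... | yes (j , j<len , a-late) = inj₂ record
    { walk = suffix w (suc j) o o+1+j≡len ; shorter = ∸-monoʳ-< (s≤s z≤n) j<len
    ; a-start = a-late ; b-end = subst (λ k → E b (ys w k) ≡ true) (sym o+1+j≡len) b-end }
    where
    o : ℕ
    o = len w ∸ suc j
    o+1+j≡len : o + suc j ≡ len w
    o+1+j≡len = m∸n+n≡m j<len
  ... | no ¬a-late with anyUpTo? (λ j → E b (ys w j) Bool.≟ true) (len w)
  ... | yes (j , j<len , b-early) = inj₂ record
    { walk = prefix w j (<⇒≤ j<len) ; shorter = j<len ; a-start = a-start ; b-end = b-early }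
  ... | no ¬b-early with anyUpTo? (λ i → anyUpTo? (chord? w i) (suc (len w))) (len w)
  ... | yes (i , i<len , j , j≤len , c) = inj₂ record
    { walk = S.walk ; shorter = S.shorter
    ; a-start = subst (λ y → E a y ≡ true) (sym S.same-start) a-start
    ; b-end = subst (λ y → E b y ≡ true) (sym S.same-end) b-end }
    where
    module S = Shortening (chordShortening w i j i<len (≤-pred j≤len) c)
  ... | no ¬chord = ⊥-elim (chordal⇒¬chordlessCycle chordal (s≤s (s≤s len>0)) (ClosedUp.cycle w len>0 a-start b-end
      (λ j j<len e → ¬a-late (j , j<len , e)) (λ j j<len e → ¬b-early (j , j<len , e)) chordless))
    where
    len>0 : 0 < len w
    len>0 = n≢0⇒n>0 λ len≡0 → b-not-start (subst (λ k → E b (ys w k) ≡ true) len≡0 b-end)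
    chordless : ∀ i j → i < len w → j ≤ len w → E (xs w i) (ys w j) ≡ true → j ≡ i ⊎ j ≡ suc i
    chordless i j i<len j≤len e with j ≟ i | j ≟ suc i
    ... | yes j≡i | _ = inj₁ j≡i
    ... | no _ | yes j≡1+i = inj₂ j≡1+i
    ... | no j≢i | no j≢1+i = ⊥-elim (¬chord (i , i<len , j , s≤s j≤len , e , j≢i , j≢1+i))

  commonNeighbour : (w : Walk) → E a (ys w 0) ≡ true → E b (ys w (len w)) ≡ true → CommonNeighbour
  commonNeighbour w = go w (<-wellFounded (len w))
    where
    go : (w : Walk) → Acc _<_ (len w) → E a (ys w 0) ≡ true → E b (ys w (len w)) ≡ true → CommonNeighbour
    go w (acc shorter-accessible) a-start b-end with improve w a-start b-end
    ... | inj₁ c = c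
    ... | inj₂ s = go S.walk (shorter-accessible S.shorter) S.a-start S.b-end
      where module S = Shorter s

-- The hexagon a, wc, b, wa, c, wb.
chordal⇒¬chordlessHexagon : ∀ {m n} {E : BipGraph m n} → ChordalBipartite E → ∀ {a b c wa wb wc} →
  E a wc ≡ true → E b wc ≡ true → E b wa ≡ true → E c wa ≡ true → E c wb ≡ true → E a wb ≡ true →
  E a wa ≢ true → E b wb ≢ true → E c wc ≢ true → ⊥
chordal⇒¬chordlessHexagon {m} {n} {E} chordal {a} {b} {c} {wa} {wb} {wc} awc bwc bwa cwa cwb awb ¬awa ¬bwb ¬cwc =
  chordal⇒¬chordlessCycle chordal ≤-refl record
    { u = us ; v = vs ; u-inj = us-inj ; v-inj = vs-inj ; edge₁ = edge₁ ; edge₂ = edge₂ ; chordless = chordless }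
  where
  us : ℕ → Fin m
  us 0 = a
  us 1 = b
  us _ = c
  vs : ℕ → Fin n
  vs 0 = wc
  vs 1 = wa
  vs _ = wb
  distinctᵘ : ∀ {x x′ y} → E x y ≡ true → E x′ y ≢ true → x ≢ x′
  distinctᵘ xy ¬x′y refl = ¬x′y xy
  distinctᵛ : ∀ {x y y′} → E x y ≡ true → E x y′ ≢ true → y ≢ y′
  distinctᵛ xy ¬xy′ refl = ¬xy′ xy
  us-inj : ∀ i j → i < 3 → j < 3 → us i ≡ us j → i ≡ j
  us-inj 0 0 _ _ _ = refl
  us-inj 0 1 _ _ e = ⊥-elim (distinctᵘ awb ¬bwb e)
  us-inj 0 2 _ _ e = ⊥-elim (distinctᵘ awc ¬cwc e)
  us-inj 1 0 _ _ e = ⊥-elim (distinctᵘ awb ¬bwb (sym e))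
  us-inj 1 1 _ _ _ = refl
  us-inj 1 2 _ _ e = ⊥-elim (distinctᵘ bwc ¬cwc e)
  us-inj 2 0 _ _ e = ⊥-elim (distinctᵘ awc ¬cwc (sym e))
  us-inj 2 1 _ _ e = ⊥-elim (distinctᵘ bwc ¬cwc (sym e))
  us-inj 2 2 _ _ _ = refl
  us-inj (suc (suc (suc _))) _ (s≤s (s≤s (s≤s ()))) _ _
  us-inj _ (suc (suc (suc _))) _ (s≤s (s≤s (s≤s ()))) _
  vs-inj : ∀ i j → i < 3 → j < 3 → vs i ≡ vs j → i ≡ j
  vs-inj 0 0 _ _ _ = refl
  vs-inj 0 1 _ _ e = ⊥-elim (distinctᵛ awc ¬awa e)
  vs-inj 0 2 _ _ e = ⊥-elim (distinctᵛ cwb ¬cwc (sym e))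
  vs-inj 1 0 _ _ e = ⊥-elim (distinctᵛ awc ¬awa (sym e))
  vs-inj 1 1 _ _ _ = refl
  vs-inj 1 2 _ _ e = ⊥-elim (distinctᵛ bwa ¬bwb e)
  vs-inj 2 0 _ _ e = ⊥-elim (distinctᵛ cwb ¬cwc e)
  vs-inj 2 1 _ _ e = ⊥-elim (distinctᵛ bwa ¬bwb (sym e))
  vs-inj 2 2 _ _ _ = refl
  vs-inj (suc (suc (suc _))) _ (s≤s (s≤s (s≤s ()))) _ _
  vs-inj _ (suc (suc (suc _))) _ (s≤s (s≤s (s≤s ()))) _
  edge₁ : ∀ i → i < 3 → E (us i) (vs i) ≡ true
  edge₁ 0 _ = awc
  edge₁ 1 _ = bwa
  edge₁ 2 _ = cwb
  edge₁ (suc (suc (suc _))) (s≤s (s≤s (s≤s ())))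
  edge₂ : ∀ i → i < 3 → E (us (cycSuc 3 i)) (vs i) ≡ true
  edge₂ 0 _ = bwc
  edge₂ 1 _ = cwa
  edge₂ 2 _ = awb
  edge₂ (suc (suc (suc _))) (s≤s (s≤s (s≤s ())))
  chordless : ∀ i j → i < 3 → j < 3 → E (us i) (vs j) ≡ true → i ≡ j ⊎ i ≡ cycSuc 3 j
  chordless 0 0 _ _ _ = inj₁ refl
  chordless 0 1 _ _ e = ⊥-elim (¬awa e)
  chordless 0 2 _ _ _ = inj₂ refl
  chordless 1 0 _ _ _ = inj₂ refl
  chordless 1 1 _ _ _ = inj₁ refl
  chordless 1 2 _ _ e = ⊥-elim (¬bwb e)
  chordless 2 0 _ _ e = ⊥-elim (¬cwc e)
  chordless 2 1 _ _ _ = inj₂ refl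
  chordless 2 2 _ _ _ = inj₁ refl
  chordless (suc (suc (suc _))) _ (s≤s (s≤s (s≤s ()))) _ _
  chordless _ (suc (suc (suc _))) _ (s≤s (s≤s (s≤s ()))) _

-- Helly's argument: if each pair among a, b, c has a common neighbour with the rest of the family,
-- but none of these three neighbours serves all of a, b, c, the six vertices form a chordless hexagon.
module Helly {m n : ℕ} (E : BipGraph m n) (chordal : ChordalBipartite E)
  (CU : Fin m → Bool) (CV : Fin n → Bool) (v : Fin n) (v∉C : CV v ≡ false)
  (v-far : ∀ x → CU x ≡ true → E x v ≡ false)
  (r : Fin m) (connected : ∀ y → CV y ≡ true → Walks.RootedWalk E CU CV r y) where

  open Walks E CU CV

  Attached : Fin m → Set
  Attached x = E x v ≡ true × ∃ λ y → CV y ≡ true × E x y ≡ true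

  attached? : ∀ x → Dec (Attached x)
  attached? x = (E x v Bool.≟ true) ×-dec any? (λ y → (CV y Bool.≟ true) ×-dec (E x y Bool.≟ true))

  pairwise : ∀ {a b} → Attached a → Attached b → Σ (Fin n) λ w → CV w ≡ true × E a w ≡ true × E b w ≡ true
  pairwise {a} {b} (av , ya , ya∈C , a-ya) (bv , yb , yb∈C , b-yb) with joinAtRoot (connected ya ya∈C) (connected yb yb∈C)
  ... | w , start , end = Pairwise.commonNeighbour E chordal CU CV v v∉C v-far a b av bv w
    (subst (λ y → E a y ≡ true) (sym start) a-ya) (subst (λ y → E b y ≡ true) (sym end) b-yb)

  helly : ∀ {a b} → Attached a → Attached b → ∀ T → All Attached T →
    Σ (Fin n) λ w → CV w ≡ true × E a w ≡ true × E b w ≡ true × All (λ t → E t w ≡ true) T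
  helly attached-a attached-b [] [] = let (w , w∈C , aw , bw) = pairwise attached-a attached-b in w , w∈C , aw , bw , []
  helly {a} {b} attached-a attached-b (c ∷ T) (attached-c ∷ attached-T)
    with helly attached-a attached-b T attached-T | helly attached-a attached-c T attached-T
       | helly attached-b attached-c T attached-T
  ... | wc , wc∈C , awc , bwc , Twc | wb , wb∈C , awb , cwb , Twb | wa , wa∈C , bwa , cwa , Twa
    with E a wa Bool.≟ true | E b wb Bool.≟ true | E c wc Bool.≟ true
  ... | yes awa | _ | _ = wa , wa∈C , awa , bwa , cwa ∷ Twa
  ... | no _ | yes bwb | _ = wb , wb∈C , awb , bwb , cwb ∷ Twb
  ... | no _ | no _ | yes cwc = wc , wc∈C , awc , bwc , cwc ∷ Twc
  ... | no ¬awa | no ¬bwb | no ¬cwc = ⊥-elim (chordal⇒¬chordlessHexagon chordal awc bwc bwa cwa cwb awb ¬awa ¬bwb ¬cwc)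

  commonNeighbourOfAttached : ∀ y₀ → CV y₀ ≡ true → Σ (Fin n) λ w → CV w ≡ true × (∀ x → Attached x → E x w ≡ true)
  commonNeighbourOfAttached y₀ y₀∈C =
    go (filter attached? (allFin m)) (All.tabulate (proj₂ ∘ ∈-filter⁻ attached? {xs = allFin m})) (λ x → ∈-filter⁺ attached? (∈-allFin x))
    where
    go : ∀ T → All Attached T → (∀ x → Attached x → x ∈ T) → Σ (Fin n) λ w → CV w ≡ true × (∀ x → Attached x → E x w ≡ true)
    go [] _ complete = y₀ , y₀∈C , λ x attached-x → case complete x attached-x of λ ()
    go (a ∷ T) (attached-a ∷ attached-T) complete =
      let (w , w∈C , aw , _ , Tw) = helly attached-a attached-a T attached-T in
      w , w∈C , λ x attached-x → All.lookup (aw ∷ Tw) (complete x attached-x)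

-- Connected components

anyᵇ : ∀ {n} → (Fin n → Bool) → Bool
anyᵇ p = does (any-true? p)

anyᵇ-intro : ∀ {n} (p : Fin n → Bool) i → p i ≡ true → anyᵇ p ≡ true
anyᵇ-intro p i pi = dec-true (any-true? p) (i , pi)

anyᵇ-elim : ∀ {n} (p : Fin n → Bool) → anyᵇ p ≡ true → ∃ λ i → p i ≡ true
anyᵇ-elim p _ with any-true? p
anyᵇ-elim p _ | yes ex = ex

-- The component of u in the subgraph induced by (AU, AV), grown layer by layer from u.
module Component {m n : ℕ} (E : BipGraph m n) (AU : Fin m → Bool) (AV : Fin n → Bool) (u : Fin m) (u∈A : AU u ≡ true) where

  reachU : ℕ → Fin m → Bool
  reachV : ℕ → Fin n → Bool
  reachU zero x = does (x Fin.≟ u)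
  reachU (suc k) x = reachU k x ∨ (AU x ∧ anyᵇ (λ y → reachV k y ∧ E x y))
  reachV zero y = false
  reachV (suc k) y = reachV k y ∨ (AV y ∧ anyᵇ (λ x → reachU k x ∧ E x y))

  reachU⊆A : ∀ k x → reachU k x ≡ true → AU x ≡ true
  reachU⊆A zero x e with x Fin.≟ u
  ... | yes refl = u∈A
  reachU⊆A (suc k) x e with ∨-elim {reachU k x} e
  ... | inj₁ e′ = reachU⊆A k x e′
  ... | inj₂ e′ = ∧-elimˡ e′

  reachV⊆A : ∀ k y → reachV k y ≡ true → AV y ≡ true
  reachV⊆A (suc k) y e with ∨-elim {reachV k y} e
  ... | inj₁ e′ = reachV⊆A k y e′
  ... | inj₂ e′ = ∧-elimˡ e′

  reachU-mono : ∀ {k j} x → k ≤ j → reachU k x ≡ true → reachU j x ≡ true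
  reachU-mono {j = zero} x z≤n e = e
  reachU-mono {j = suc j} x k≤1+j e with m≤n⇒m<n∨m≡n k≤1+j
  ... | inj₁ k≤j = ∨-introˡ (reachU-mono x (≤-pred k≤j) e)
  ... | inj₂ refl = e

  reachV-mono : ∀ {k j} y → k ≤ j → reachV k y ≡ true → reachV j y ≡ true
  reachV-mono {j = zero} y z≤n e = e
  reachV-mono {j = suc j} y k≤1+j e with m≤n⇒m<n∨m≡n k≤1+j
  ... | inj₁ k≤j = ∨-introˡ (reachV-mono y (≤-pred k≤j) e)
  ... | inj₂ refl = e

  Stable : ℕ → Set
  Stable k = (∀ x → reachU (suc k) x ≡ true → reachU k x ≡ true) × (∀ y → reachV (suc k) y ≡ true → reachV k y ≡ true)

  stable-suc : ∀ k → Stable k → Stable (suc k)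
  stable-suc k (stableU , stableV) = stableU′ , stableV′
    where
    stableU′ : ∀ x → reachU (suc (suc k)) x ≡ true → reachU (suc k) x ≡ true
    stableU′ x e with ∨-elim {reachU (suc k) x} e
    ... | inj₁ e′ = e′
    ... | inj₂ e′ with anyᵇ-elim _ (∧-elimʳ {AU x} e′)
    ...   | y , ey = ∨-introʳ {reachU k x} (∧-intro (∧-elimˡ {AU x} e′)
              (anyᵇ-intro (λ y → reachV k y ∧ E x y) y (∧-intro (stableV y (∧-elimˡ ey)) (∧-elimʳ {reachV (suc k) y} ey))))
    stableV′ : ∀ y → reachV (suc (suc k)) y ≡ true → reachV (suc k) y ≡ true
    stableV′ y e with ∨-elim {reachV (suc k) y} e
    ... | inj₁ e′ = e′
    ... | inj₂ e′ with anyᵇ-elim _ (∧-elimʳ {AV y} e′)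
    ...   | x , ex = ∨-introʳ {reachV k y} (∧-intro (∧-elimˡ {AV y} e′)
              (anyᵇ-intro (λ x → reachU k x ∧ E x y) x (∧-intro (stableU x (∧-elimˡ ex)) (∧-elimʳ {reachU (suc k) x} ex))))

  size : ℕ → ℕ
  size k = count (reachU k) + count (reachV k)

  Grows : ℕ → Set
  Grows k = (∃ λ x → reachU (suc k) x ≡ true × reachU k x ≡ false) ⊎ (∃ λ y → reachV (suc k) y ≡ true × reachV k y ≡ false)

  stable-or-grows : ∀ k → Stable k ⊎ Grows k
  stable-or-grows k with any-true? (λ x → reachU (suc k) x ∧ not (reachU k x)) | any-true? (λ y → reachV (suc k) y ∧ not (reachV k y))
  ... | yes (x , e) | _ = inj₂ (inj₁ (x , ∧-elimˡ e , not-true (∧-elimʳ {reachU (suc k) x} e)))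
  ... | no _ | yes (y , e) = inj₂ (inj₂ (y , ∧-elimˡ e , not-true (∧-elimʳ {reachV (suc k) y} e)))
  ... | no ¬newU | no ¬newV = inj₁ (old ¬newU , old ¬newV)
    where
    old : ∀ {N} {p q : Fin N → Bool} → ¬ (∃ λ i → q i ∧ not (p i) ≡ true) → ∀ i → q i ≡ true → p i ≡ true
    old {p = p} ¬new i qi with p i in pi
    ... | true = refl
    ... | false = ⊥-elim (¬new (i , ∧-intro qi (not-false pi)))

  grows⇒size< : ∀ k → Grows k → size k < size (suc k)
  grows⇒size< k (inj₁ (x , new , old)) =
    +-mono-<-≤ (count-strict {q = reachU (suc k)} (λ _ → ∨-introˡ) x new old) (count-mono {q = reachV (suc k)} (λ _ → ∨-introˡ))
  grows⇒size< k (inj₂ (y , new , old)) =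
    +-mono-≤-< (count-mono {q = reachU (suc k)} (λ _ → ∨-introˡ)) (count-strict {q = reachV (suc k)} (λ _ → ∨-introˡ) y new old)

  ¬stable×grows : ∀ k → Stable k → Grows k → ⊥
  ¬stable×grows k (stableU , _) (inj₁ (x , new , old)) = false≢true (trans (sym old) (stableU x new))
  ¬stable×grows k (_ , stableV) (inj₂ (y , new , old)) = false≢true (trans (sym old) (stableV y new))

  stable-or-large : ∀ k → Stable k ⊎ suc k ≤ size k
  stable-or-large zero = inj₂ (≤-trans (∃⇒count>0 (reachU 0) (u , reachU-root)) (m≤m+n _ _))
    where
    reachU-root : reachU 0 u ≡ true
    reachU-root with u Fin.≟ u
    ... | yes _ = refl
    ... | no u≢u = ⊥-elim (u≢u refl)
  stable-or-large (suc k) with stable-or-grows (suc k)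
  ... | inj₁ stable = inj₁ stable
  ... | inj₂ grows with stable-or-grows k
  ...   | inj₁ stable = ⊥-elim (¬stable×grows (suc k) (stable-suc k stable) grows)
  ...   | inj₂ grows′ with stable-or-large k
  ...     | inj₁ stable = ⊥-elim (¬stable×grows k stable grows′)
  ...     | inj₂ large = inj₂ (<-≤-trans (s≤s large) (grows⇒size< k grows′))

  M : ℕ
  M = m + n

  stable : Stable M
  stable with stable-or-large M
  ... | inj₁ s = s
  ... | inj₂ large = ⊥-elim (<⇒≱ large (+-mono-≤ (count≤n (reachU M)) (count≤n (reachV M))))

  CU : Fin m → Bool
  CU = reachU M

  CV : Fin n → Bool
  CV = reachV M

  root∈C : CU u ≡ true
  root∈C = reachU-mono {0} {M} u z≤n (dec-true (u Fin.≟ u) refl)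

  C⊆Aᵘ : ∀ x → CU x ≡ true → AU x ≡ true
  C⊆Aᵘ = reachU⊆A M

  C⊆Aᵛ : ∀ y → CV y ≡ true → AV y ≡ true
  C⊆Aᵛ = reachV⊆A M

  closedᵛ : ∀ x y → CU x ≡ true → AV y ≡ true → E x y ≡ true → CV y ≡ true
  closedᵛ x y x∈C y∈A xy = proj₂ stable y (∨-introʳ (∧-intro y∈A (anyᵇ-intro (λ x → CU x ∧ E x y) x (∧-intro x∈C xy))))

  closedᵘ : ∀ x y → CV y ≡ true → AU x ≡ true → E x y ≡ true → CU x ≡ true
  closedᵘ x y y∈C x∈A xy = proj₁ stable x (∨-introʳ (∧-intro x∈A (anyᵇ-intro (λ y → CV y ∧ E x y) y (∧-intro y∈C xy))))

  open Walks E CU CV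

  reachU-root-or-next : ∀ k x → reachU k x ≡ true → x ≡ u ⊎ ∃ λ y → reachV k y ≡ true × E x y ≡ true
  reachU-root-or-next zero x e with x Fin.≟ u
  ... | yes x≡u = inj₁ x≡u
  reachU-root-or-next (suc k) x e with ∨-elim {reachU k x} e
  ... | inj₁ e′ with reachU-root-or-next k x e′
  ...   | inj₁ x≡u = inj₁ x≡u
  ...   | inj₂ (y , y∈ , xy) = inj₂ (y , ∨-introˡ y∈ , xy)
  reachU-root-or-next (suc k) x e | inj₂ e′ with anyᵇ-elim _ (∧-elimʳ {AU x} e′)
  ... | y , ey = inj₂ (y , ∨-introˡ (∧-elimˡ {reachV k y} ey) , ∧-elimʳ {reachV k y} ey)

  walkTo : ∀ k → k ≤ M → ∀ y → reachV k y ≡ true → RootedWalk u y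
  walkTo (suc k) 1+k≤M y e with ∨-elim {reachV k y} e
  ... | inj₁ e′ = walkTo k (≤-trans (n≤1+n k) 1+k≤M) y e′
  ... | inj₂ e′ with anyᵇ-elim _ (∧-elimʳ {AV y} e′)
  ...   | x , ex with reachU-root-or-next k x (∧-elimˡ ex)
  ...     | inj₁ refl = single root∈C (reachV-mono y 1+k≤M e) (∧-elimʳ {reachU k u} ex)
  ...     | inj₂ (y′ , y′∈ , xy′) = extend x (walkTo k (≤-trans (n≤1+n k) 1+k≤M) y′ y′∈) xy′ (∧-elimʳ {reachU k x} ex)
              (reachU-mono x (≤-trans (n≤1+n k) 1+k≤M) (∧-elimˡ ex)) (reachV-mono y 1+k≤M e)

  connected : ∀ y → CV y ≡ true → RootedWalk u y
  connected = walkTo M ≤-refl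

-- Weakly simplicial vertices

NbrSubset : ∀ {m n} → BipGraph m n → (Fin m → Bool) → Fin n → Fin n → Set
NbrSubset E HU y y′ = ∀ x → HU x ≡ true → E x y ≡ true → E x y′ ≡ true

WeaklySimplicial : ∀ {m n} → BipGraph m n → (Fin m → Bool) → (Fin n → Bool) → Fin m → Set
WeaklySimplicial E HU HV x =
  ∀ y y′ → HV y ≡ true → HV y′ ≡ true → E x y ≡ true → E x y′ ≡ true → NbrSubset E HU y y′ ⊎ NbrSubset E HU y′ y

weaklySimplicial-─ : ∀ {m n} (E : BipGraph m n) {HU HV x w} → (∀ y → HV y ≡ true → E x y ≡ true → NbrSubset E HU y w) →
  WeaklySimplicial E HU (HV ─ w) x → WeaklySimplicial E HU HV x
weaklySimplicial-─ E {HV = HV} {w = w} ⊆w ws y y′ hy hy′ xy xy′ with y Fin.≟ w | y′ Fin.≟ w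
... | yes refl | _ = inj₂ (⊆w y′ hy′ xy′)
... | no _ | yes refl = inj₁ (⊆w y hy xy)
... | no y≢w | no y′≢w = ws y y′ (─-intro HV hy y≢w) (─-intro HV hy′ y′≢w) xy xy′

-- Every nonempty induced subgraph H = (HU, HV) has a weakly simplicial vertex in U. The search keeps a
-- connected piece C of H that is closed towards V and either a whole component of H or attached to
-- the rest of H only through the neighbours of one vertex v ∉ C; by Helly, some w ∈ C is adjacent to
-- all of those. If w misses some u ∈ C, recurse into the component of u away from w; otherwise N(w)
-- contains the neighbourhood of every vertex of C, so w may be deleted from H.
module WeaklySimplicialVertex {m n : ℕ} (E : BipGraph m n) (chordal : ChordalBipartite E) where

  Dominates : (Fin m → Bool) → (Fin m → Bool) → (Fin n → Bool) → Fin n → Set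
  Dominates HU CU CV w = ∀ x y → CV y ≡ true → HU x ≡ true → E x y ≡ true → CU x ≡ false → E x w ≡ true

  data Boundary (HU CU : Fin m → Bool) (CV : Fin n → Bool) : Set where
    component : (∀ x y → CV y ≡ true → HU x ≡ true → E x y ≡ true → CU x ≡ true) → Boundary HU CU CV
    attachedVia : ∀ v → CV v ≡ false → (∀ x → CU x ≡ true → E x v ≡ false) → Dominates HU CU CV v → Boundary HU CU CV

  record Piece (HU : Fin m → Bool) (HV : Fin n → Bool) : Set where
    field
      CU : Fin m → Bool
      CV : Fin n → Bool
      root : Fin m
      root∈C : CU root ≡ true
      closed : ∀ x y → CU x ≡ true → HV y ≡ true → E x y ≡ true → CV y ≡ true
      connected : ∀ y → CV y ≡ true → Walks.RootedWalk E CU CV root y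
      boundary : Boundary HU CU CV

  record Smaller {HU HV HV′} (P : Piece HU HV) : Set where
    field
      piece : Piece HU HV′
      ⊆P : ∀ x → Piece.CU piece x ≡ true → Piece.CU P x ≡ true
      smaller : count (Piece.CV piece) < count (Piece.CV P)

  module _ {HU : Fin m → Bool} {HV : Fin n → Bool} (P : Piece HU HV) where
    open Piece P

    hub : ∀ y₀ → CV y₀ ≡ true → Σ (Fin n) λ w → CV w ≡ true × Dominates HU CU CV w
    hub y₀ y₀∈C with boundary
    ... | component comp = y₀ , y₀∈C , λ x y y∈C hx xy x∉C → ⊥-elim (false≢true (trans (sym x∉C) (comp x y y∈C hx xy)))
    ... | attachedVia v v∉C v-far dom with Helly.commonNeighbourOfAttached E chordal CU CV v v∉C v-far root connected y₀ y₀∈C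
    ...   | w , w∈C , w-common = w , w∈C , λ x y y∈C hx xy x∉C → w-common x (dom x y y∈C hx xy x∉C , y , y∈C , xy)

    awayFrom : ∀ w → CV w ≡ true → Dominates HU CU CV w → ∀ u → CU u ≡ true → E u w ≡ false → Smaller {HV′ = HV} P
    awayFrom w w∈C w-dom u u∈C ¬uw = record
      { piece = record
        { CU = K.CU ; CV = K.CV ; root = u ; root∈C = K.root∈C
        ; closed = λ x y x∈K hy xy → K.closedᵛ x y x∈K (─-intro CV (closed x y (K⊆Cᵘ x x∈K) hy xy) (λ { refl → ¬xw x∈K xy })) xy
        ; connected = K.connected
        ; boundary = attachedVia w w∉K (λ x x∈K → not-true (∧-elimʳ {CU x} (K.C⊆Aᵘ x x∈K))) dom
        }
      ; ⊆P = K⊆Cᵘ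
      ; smaller = count-strict (λ y y∈K → ─-⊆ CV (K.C⊆Aᵛ y y∈K)) w w∈C w∉K
      }
      where
      module K = Component E (λ x → CU x ∧ not (E x w)) (CV ─ w) u (∧-intro u∈C (not-false ¬uw))
      w∉K : K.CV w ≡ false
      w∉K = ¬-not λ w∈K → ─-≢ CV (K.C⊆Aᵛ w w∈K) refl
      K⊆Cᵘ : ∀ x → K.CU x ≡ true → CU x ≡ true
      K⊆Cᵘ x x∈K = ∧-elimˡ (K.C⊆Aᵘ x x∈K)
      ¬xw : ∀ {x} → K.CU x ≡ true → E x w ≢ true
      ¬xw {x} x∈K xw = false≢true (trans (sym (not-true (∧-elimʳ {CU x} (K.C⊆Aᵘ x x∈K)))) xw)
      dom : Dominates HU K.CU K.CV w
      dom x y y∈K hx xy x∉K with CU x in x∈C | E x w in xw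
      ... | _ | true = refl
      ... | false | false = ⊥-elim (false≢true (trans (sym xw) (w-dom x y (─-⊆ CV (K.C⊆Aᵛ y y∈K)) hx xy x∈C)))
      ... | true | false = ⊥-elim (false≢true (trans (sym x∉K) (K.closedᵘ x y y∈K (∧-intro x∈C (not-false xw)) xy)))

    withoutHub : ∀ w → CV w ≡ true → (∀ x → CU x ≡ true → E x w ≡ true) → Smaller {HV′ = HV ─ w} P
    withoutHub w w∈C all-w = record
      { piece = record
        { CU = K.CU ; CV = K.CV ; root = root ; root∈C = K.root∈C
        ; closed = λ x y x∈K hy xy → K.closedᵛ x y x∈K (─-intro CV (closed x y (K.C⊆Aᵘ x x∈K) (─-⊆ HV hy) xy) (─-≢ HV hy)) xy
        ; connected = K.connected
        ; boundary = boundary′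
        }
      ; ⊆P = K.C⊆Aᵘ
      ; smaller = count-strict K⊆Cᵛ w w∈C w∉K
      }
      where
      module K = Component E CU (CV ─ w) root root∈C
      K⊆Cᵛ : ∀ y → K.CV y ≡ true → CV y ≡ true
      K⊆Cᵛ y y∈K = ─-⊆ CV (K.C⊆Aᵛ y y∈K)
      w∉K : K.CV w ≡ false
      w∉K = ¬-not λ w∈K → ─-≢ CV (K.C⊆Aᵛ w w∈K) refl
      boundary′ : Boundary HU K.CU K.CV
      boundary′ with boundary
      ... | component comp = component λ x y y∈K hx xy → K.closedᵘ x y y∈K (comp x y (K⊆Cᵛ y y∈K) hx xy) xy
      ... | attachedVia v v∉C v-far dom = attachedVia v v∉K (λ x x∈K → v-far x (K.C⊆Aᵘ x x∈K)) dom′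
        where
        v∉K : K.CV v ≡ false
        v∉K = ¬-not λ v∈K → false≢true (trans (sym v∉C) (K⊆Cᵛ v v∈K))
        dom′ : Dominates HU K.CU K.CV v
        dom′ x y y∈K hx xy x∉K with CU x in x∈C
        ... | false = dom x y (K⊆Cᵛ y y∈K) hx xy x∈C
        ... | true = ⊥-elim (false≢true (trans (sym x∉K) (K.closedᵘ x y y∈K x∈C xy)))

    hub-dominates : ∀ {w} → Dominates HU CU CV w → (∀ x → CU x ≡ true → E x w ≡ true) → ∀ y → CV y ≡ true → NbrSubset E HU y w
    hub-dominates w-dom all-w y y∈C x hx xy with CU x in x∈C
    ... | true = all-w x x∈C
    ... | false = w-dom x y y∈C hx xy x∈C

  weaklySimplicialIn : ∀ {HU HV} (P : Piece HU HV) → Σ (Fin m) λ x → Piece.CU P x ≡ true × WeaklySimplicial E HU HV x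
  weaklySimplicialIn P = go P (<-wellFounded _)
    where
    go : ∀ {HU HV} (P : Piece HU HV) → Acc _<_ (count (Piece.CV P)) →
      Σ (Fin m) λ x → Piece.CU P x ≡ true × WeaklySimplicial E HU HV x
    go P (acc rec) with any-true? (Piece.CV P)
    ... | no empty = root , root∈C , λ y _ hy _ xy _ → ⊥-elim (empty (y , closed root y root∈C hy xy))
      where open Piece P
    ... | yes (y₀ , y₀∈C) with hub P y₀ y₀∈C
    ... | w , w∈C , w-dom with any-true? (λ x → Piece.CU P x ∧ not (E x w))
    ...   | yes (u , e) =
      let (x , x∈S , ws) = go S.piece (rec S.smaller) in x , S.⊆P x x∈S , ws
      where module S = Smaller (awayFrom P w w∈C w-dom u (∧-elimˡ e) (not-true (∧-elimʳ {Piece.CU P u} e)))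
    ...   | no ¬away =
      let (x , x∈S , ws) = go S.piece (rec S.smaller) in
      x , S.⊆P x x∈S , weaklySimplicial-─ E (λ y hy xy → hub-dominates P w-dom all-w y (Piece.closed P x y (S.⊆P x x∈S) hy xy)) ws
      where
      all-w : ∀ x → Piece.CU P x ≡ true → E x w ≡ true
      all-w x x∈C with E x w in xw
      ... | true = refl
      ... | false = ⊥-elim (¬away (x , ∧-intro x∈C (not-false xw)))
      module S = Smaller (withoutHub P w w∈C all-w)

  weaklySimplicialVertex : ∀ HU HV u → HU u ≡ true → Σ (Fin m) λ x → HU x ≡ true × WeaklySimplicial E HU HV x
  weaklySimplicialVertex HU HV u u∈H =
    let (x , x∈K , ws) = weaklySimplicialIn piece in x , K.C⊆Aᵘ x x∈K , ws
    where
    module K = Component E HU HV u u∈H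
    piece : Piece HU HV
    piece = record
      { CU = K.CU ; CV = K.CV ; root = u ; root∈C = K.root∈C
      ; closed = K.closedᵛ ; connected = K.connected ; boundary = component λ x y y∈K hx xy → K.closedᵘ x y y∈K hx xy }

-- Degeneracy

module Degrees {m n : ℕ} (E : BipGraph m n) where

  degU : (Fin n → Bool) → Fin m → ℕ
  degU HV x = count (λ y → HV y ∧ E x y)

  degV : (Fin m → Bool) → Fin n → ℕ
  degV HU y = count (λ x → HU x ∧ E x y)

  edges : (Fin m → Bool) → (Fin n → Bool) → ℕ
  edges HU HV = sum (λ x → if HU x then degU HV x else 0)

  edges-─ᵘ : ∀ HU HV {z} → HU z ≡ true → edges HU HV ≡ edges (HU ─ z) HV + degU HV z
  edges-─ᵘ HU HV {z} z∈H = trans (sum-update _ _ z off-z at-z) (cong (λ b → edges (HU ─ z) HV + (if b then degU HV z else 0)) z∈H)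
    where
    off-z : ∀ x → x ≢ z → (if HU x then degU HV x else 0) ≡ (if (HU ─ z) x then degU HV x else 0)
    off-z x x≢z rewrite ─-other HU x≢z = refl
    at-z : (if (HU ─ z) z then degU HV z else 0) ≡ 0
    at-z rewrite ─-self HU z = refl

  degU-─ : ∀ HV {z} x → HV z ≡ true → degU HV x ≡ degU (HV ─ z) x + [ E x z ]
  degU-─ HV {z} x z∈H = trans (sum-update _ _ z off-z at-z) (cong (λ b → degU (HV ─ z) x + [ b ∧ E x z ]) z∈H)
    where
    off-z : ∀ y → y ≢ z → [ HV y ∧ E x y ] ≡ [ (HV ─ z) y ∧ E x y ]
    off-z y y≢z rewrite ─-other HV y≢z = refl
    at-z : [ (HV ─ z) z ∧ E x z ] ≡ 0
    at-z rewrite ─-self HV z = refl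

  edges-─ᵛ : ∀ HU HV {z} → HV z ≡ true → edges HU HV ≡ edges HU (HV ─ z) + degV HU z
  edges-─ᵛ HU HV {z} z∈H = trans (sum-cong-≗ split) (∑-distrib-+ (λ x → if HU x then degU (HV ─ z) x else 0) (λ x → [ HU x ∧ E x z ]))
    where
    split : ∀ x → (if HU x then degU HV x else 0) ≡ (if HU x then degU (HV ─ z) x else 0) + [ HU x ∧ E x z ]
    split x with HU x
    ... | true = degU-─ HV x z∈H
    ... | false = refl

module Degeneracy {m n : ℕ} (E : BipGraph m n) (d : ℕ) where
  open Degrees E

  HasLowVertex : (Fin m → Bool) → (Fin n → Bool) → Set
  HasLowVertex HU HV = (∃ λ x → HU x ≡ true × degU HV x ≤ d) ⊎ (∃ λ y → HV y ≡ true × degV HU y ≤ d)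

  edges≤ : (∀ HU HV → (∃ λ x → HU x ≡ true) ⊎ (∃ λ y → HV y ≡ true) → HasLowVertex HU HV) →
    ∀ HU HV → edges HU HV ≤ (count HU + count HV) * d
  edges≤ low HU HV = go HU HV (<-wellFounded _)
    where
    peel : ∀ {e e′ δ c c′} → e ≡ e′ + δ → e′ ≤ c′ * d → δ ≤ d → c ≡ suc c′ → e ≤ c * d
    peel refl e′≤ δ≤d refl = ≤-trans (+-mono-≤ e′≤ δ≤d) (≤-reflexive (+-comm _ d))

    go : ∀ HU HV → Acc _<_ (count HU + count HV) → edges HU HV ≤ (count HU + count HV) * d
    peelLow : ∀ HU HV → Acc _<_ (count HU + count HV) → HasLowVertex HU HV → edges HU HV ≤ (count HU + count HV) * d

    go HU HV accessible with any-true? HU | any-true? HV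
    ... | yes ex | _ = peelLow HU HV accessible (low HU HV (inj₁ ex))
    ... | no _ | yes ex = peelLow HU HV accessible (low HU HV (inj₂ ex))
    ... | no ¬U | no _ = subst (_≤ _) (sym (sum-zero _ empty)) z≤n
      where
      empty : ∀ x → (if HU x then degU HV x else 0) ≡ 0
      empty x rewrite ¬-not {HU x} (λ x∈H → ¬U (x , x∈H)) = refl

    peelLow HU HV (acc rec) (inj₁ (x , x∈H , deg≤d)) =
      peel (edges-─ᵘ HU HV x∈H) (go (HU ─ x) HV (rec (≤-reflexive (sym size≡)))) deg≤d size≡
      where
      size≡ : count HU + count HV ≡ suc (count (HU ─ x) + count HV)
      size≡ = cong (_+ count HV) (count-remove HU x∈H)
    peelLow HU HV (acc rec) (inj₂ (y , y∈H , deg≤d)) =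
      peel (edges-─ᵛ HU HV y∈H) (go HU (HV ─ y) (rec (≤-reflexive (sym size≡)))) deg≤d size≡
      where
      size≡ : count HU + count HV ≡ suc (count HU + count (HV ─ y))
      size≡ = trans (cong (count HU +_) (count-remove HV y∈H)) (+-suc _ _)

-- A weakly simplicial x and its neighbour y of least degree: all neighbours of x are adjacent to all
-- neighbours of y, since each neighbourhood N(b) of a neighbour b of x either contains N(y) or is
-- contained in it, and then equals it by minimality.
module _ {m n : ℕ} (E : BipGraph m n) (k : ℕ) (¬K : ¬ ContainsKkk E (suc k)) where
  open Degrees E
  open Degeneracy E k

  weaklySimplicial⇒lowVertex : ∀ HU HV x → HU x ≡ true → WeaklySimplicial E HU HV x → HasLowVertex HU HV
  weaklySimplicial⇒lowVertex HU HV x x∈H ws with degU HV x ≤? k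
  ... | yes x-low = inj₁ (x , x∈H , x-low)
  ... | no x-high with argmin (λ y → HV y ∧ E x y) (degV HU) (count>0⇒∃ _ (≤-trans (s≤s z≤n) (≰⇒> x-high)))
  ...   | y , xy , y-min with degV HU y ≤? k
  ...     | yes y-low = inj₂ (y , ∧-elimˡ xy , y-low)
  ...     | no y-high with count≥⇒injection (suc k) (λ x′ → HU x′ ∧ E x′ y) (≰⇒> y-high)
                         | count≥⇒injection (suc k) (λ y′ → HV y′ ∧ E x y′) (≰⇒> x-high)
  ...       | as , as-inj , as∈ | bs , bs-inj , bs∈ = ⊥-elim (¬K (as , bs , as-inj , bs-inj , complete))
    where
    complete : ∀ i j → E (as i) (bs j) ≡ true
    complete i j with ws y (bs j) (∧-elimˡ xy) (∧-elimˡ (bs∈ j)) (∧-elimʳ {HV y} xy) (∧-elimʳ {HV (bs j)} (bs∈ j))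
    ... | inj₁ y⊆b = y⊆b (as i) (∧-elimˡ (as∈ i)) (∧-elimʳ {HU (as i)} (as∈ i))
    ... | inj₂ b⊆y = ∧-elimʳ {HU (as i)} (count-⊆⇒⊇ {p = λ x′ → HU x′ ∧ E x′ (bs j)} {q = λ x′ → HU x′ ∧ E x′ y}
            (λ x′ e → ∧-intro (∧-elimˡ e) (b⊆y x′ (∧-elimˡ e) (∧-elimʳ {HU x′} e))) (y-min (bs j) (bs∈ j)) (as i) (as∈ i))

  chordal⇒lowVertex : ChordalBipartite E → ∀ HU HV → (∃ λ x → HU x ≡ true) ⊎ (∃ λ y → HV y ≡ true) → HasLowVertex HU HV
  chordal⇒lowVertex chordal HU HV nonempty with any-true? HU | nonempty
  ... | yes (u , u∈H) | _ = let (x , x∈H , ws) = weaklySimplicialVertex HU HV u u∈H in weaklySimplicial⇒lowVertex HU HV x x∈H ws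
    where open WeaklySimplicialVertex E chordal
  ... | no ¬U | inj₁ ex = ⊥-elim (¬U ex)
  ... | no ¬U | inj₂ (y , y∈H) = inj₂ (y , y∈H , subst (_≤ k) (sym (count-empty _ isolated)) z≤n)
    where
    isolated : ∀ x → HU x ∧ E x y ≡ false
    isolated x = cong (_∧ E x y) (¬-not λ x∈H → ¬U (x , x∈H))

edgeCount≡edges : ∀ {m n} (E : BipGraph m n) → edgeCount E ≡ Degrees.edges E (λ _ → true) (λ _ → true)
edgeCount≡edges {m} {n} E =
  trans (sum-tabulate m id (λ x → List.sum (map (λ y → [ E x y ]) (allFin n)))) (sum-cong-≗ λ x → sum-tabulate n id (λ y → [ E x y ]))

theorem10 : (m n k : ℕ) → NonZero m → NonZero n → NonZero k → (E : BipGraph m n) → ChordalBipartite E → ¬ ContainsKkk E k → edgeCount E ≤ (m + n) * (k ∸ 1)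
theorem10 m n zero _ _ record { nonZero = () } E chordal ¬K
theorem10 m n (suc k) _ _ _ E chordal ¬K = begin
  edgeCount E                                           ≡⟨ edgeCount≡edges E ⟩
  edges (λ _ → true) (λ _ → true)                       ≤⟨ edges≤ (chordal⇒lowVertex E k ¬K chordal) _ _ ⟩
  (count {m} (λ _ → true) + count {n} (λ _ → true)) * k ≡⟨ cong₂ (λ a b → (a + b) * k) (count-full m) (count-full n) ⟩
  (m + n) * k                                           ∎
  where
  open Degrees E
  open Degeneracy E k
  open ≤-Reasoning
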